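{- Let $n\ge2$, and let $D=\{d_1,\ldots,d_k\}\subseteq\{2,3,\ldots,n\}$ with $2\le d_1<\cdots<d_k\le n$. Let $G(S_n,D)$ be the distance graph of $(S_n,\rho)$ with distance set $D$, where $\rho$ is the RT metric on $S_n$. Define graphs recursively by $H_1=K_{d_1}((d_1-1)!)$ and $H_j=\left[\frac{(d_j-1)!}{d_{j-1}!}H_{j-1}\right]^{d_j}$ for $j=2,\ldots,k$. Then $$G(S_n,D)\cong \frac{n!}{d_k!}\,H_k,$$ i.e. $G(S_n,D)\cong\frac{n!}{d_k!}\left[\frac{(d_k-1)!}{d_{k-1}!}\left[\cdots\left[\frac{(d_2-1)!}{d_1!}K_{d_1}((d_1-1)!)\right]^{d_2}\cdots\right]^{d_{k-1}}\right]^{d_k}$.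
   Context: $S_n$ is the symmetric group on $\{1,\ldots,n\}$. For $\alpha\in S_n$, $\omega(\alpha)=\max\{i:\alpha(i)\ne i\}$ (and $0$ for the identity), and the RT distance is $\rho(\alpha,\beta)=\omega(\alpha^{ -1}\beta)$, which equals $\max\{i:\alpha(i)\neq\beta(i)\}$ for $\alpha\ne\beta$. For a metric space $(X,d)$ and a set $D$ of positive reals, the distance graph $G(X,D)$ has vertex set $X$ and an edge $xy$ for distinct $x,y\in X$ whenever $d(x,y)\in D$. For a graph $G$ and positive integer $m$, $mG$ denotes the disjoint union of $m$ copies of $G$, and $[G]^m$ denotes the join of $m$ copies of $G$ (disjoint union of the copies together with all edges between vertices of different copies). $K_r(m)$ denotes the complete $r$-partite graph with every part of size $m$. -}

module Defs where

open import Data.Nat using (ℕ; zero; suc; _∸_; _/_; _!)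
open import Data.Nat.Properties using (_!≢0)
open import Data.Fin using (Fin; fromℕ; inject₁)
open import Data.Fin.Properties using () renaming (_≟_ to _≟ᶠ_)
open import Data.Fin.Permutation using (Permutation′; _⟨$⟩ʳ_; flip; _∘ₚ_)
import Data.Fin.Permutation as Perm
open import Data.Product using (_×_; _,_; Σ)
open import Data.Sum using (_⊎_)
open import Data.List using (List; []; _∷_)
open import Data.List.Membership.Propositional using (_∈_)
open import Relation.Binary.PropositionalEquality using (_≡_; _≢_)
open import Relation.Nullary using (¬_; yes; no)
open import Function using (_∘_; _⇔_)

-- Graphs: a vertex type with an equality (setoid-style) and an adjacency
-- relation.  (Vertex equality is a relation because permutations are
-- compared pointwise.)

record Graph : Set₁ where
  field
    V   : Set
    _≈_ : V → V → Set
    Adj : V → V → Set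

open Graph public

record _≅_ (G H : Graph) : Set where
  field
    to       : V G → V H
    from     : V H → V G
    to-cong  : ∀ {x y} → _≈_ G x y → _≈_ H (to x) (to y)
    from-cong : ∀ {x y} → _≈_ H x y → _≈_ G (from x) (from y)
    from-to  : ∀ x → _≈_ G (from (to x)) x
    to-from  : ∀ y → _≈_ H (to (from y)) y
    adj      : ∀ x y → Adj G x y ⇔ Adj H (to x) (to y)

-- m G : disjoint union of m copies of G
copies : ℕ → Graph → Graph
copies m G = record
  { V   = Fin m × V G
  ; _≈_ = λ { (i , x) (j , y) → i ≡ j × _≈_ G x y }
  ; Adj = λ { (i , x) (j , y) → i ≡ j × Adj G x y }
  }

-- [G]^m : join of m copies of G
joinPow : Graph → ℕ → Graph
joinPow G m = record
  { V   = Fin m × V G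
  ; _≈_ = λ { (i , x) (j , y) → i ≡ j × _≈_ G x y }
  ; Adj = λ { (i , x) (j , y) → (i ≡ j × Adj G x y) ⊎ i ≢ j }
  }

completeMultipartite : ℕ → ℕ → Graph
completeMultipartite r m = record
  { V   = Fin r × Fin m
  ; _≈_ = _≡_
  ; Adj = λ { (i , a) (j , b) → i ≢ j }
  }

-- largest (1-based) index i with f i ≢ g i, or 0 if f and g agree
lastDiff : ∀ {m n} → (Fin m → Fin n) → (Fin m → Fin n) → ℕ
lastDiff {zero}  f g = 0
lastDiff {suc m} f g with f (fromℕ m) ≟ᶠ g (fromℕ m)
... | yes _ = lastDiff (f ∘ inject₁) (g ∘ inject₁)
... | no  _ = suc m

ω : ∀ {n} → Permutation′ n → ℕ
ω α = lastDiff (α ⟨$⟩ʳ_) (λ i → i)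

-- ρ(α,β) = ω(α⁻¹β);  (β ∘ₚ flip α) is the map i ↦ α⁻¹(β(i))
ρ : ∀ {n} → Permutation′ n → Permutation′ n → ℕ
ρ α β = ω (β ∘ₚ flip α)

distanceGraph : (n : ℕ) → List ℕ → Graph
distanceGraph n D = record
  { V   = Permutation′ n
  ; _≈_ = Perm._≈_
  ; Adj = λ α β → ¬ (α Perm.≈ β) × ρ α β ∈ D
  }

facQuot : ℕ → ℕ → ℕ
facQuot a b = ((a ∸ 1) !) / (b !) where instance _ = b !≢0

-- Hstep p G ds : starting from G = H_{j-1} with d_{j-1} = p, apply
-- H_j = [ ((d_j - 1)!/d_{j-1}!) H_{j-1} ]^{d_j} for each d_j in ds
Hstep : ℕ → Graph → List ℕ → Graph
Hstep p G []       = G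
Hstep p G (d ∷ ds) = Hstep d (joinPow (copies (facQuot d p) G) d) ds

H : ℕ → List ℕ → Graph
H d₁ ds = Hstep d₁ (completeMultipartite d₁ ((d₁ ∸ 1) !)) ds

lastOf : ℕ → List ℕ → ℕ
lastOf d []       = d
lastOf d (e ∷ es) = lastOf e es

-- Sending α ∈ S_{n+1} to (α(n+1), α with n+1 deleted) is a bijection S_{n+1} ≅ [n+1] × S_n,
-- and ρ(α, β) = n+1 if the first components differ, while otherwise ρ(α, β) is the distance
-- of the second components. Hence G(S_{n+1}, D) is (n+1) G(S_n, D) when n+1 ∉ D and the
-- join [G(S_n, D)]^{n+1} when n+1 ∈ D. Iterating from G(S₀, D) = K₁, the copies made
-- between d_{j-1} and d_j multiply up to (d_j - 1)!/d_{j-1}!, and each d_j adds a join.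
module Submission where

open import Defs
open import Data.Nat using (ℕ; zero; suc; _≤_; _<_; _≤′_; ≤′-refl; ≤′-step; _/_; _!; _*_; _∸_; z≤n; s≤s)
open import Data.Nat.Properties using (_!≢0; ≤-refl; ≤-trans; m≤n⇒m≤1+n; <-irrefl; <-trans; ≤⇒≤′; ≤′⇒≤; <⇒≱)
open import Data.Nat.DivMod using (n/n≡1; n/1≡n; *-/-assoc)
open import Data.Nat.Divisibility using (m≤n⇒m!∣n!)
open import Data.Fin using (Fin; fromℕ; inject₁; punchIn; punchOut; combine; remQuot) renaming (zero to fzero; suc to fsuc)
open import Data.Fin.Properties using (punchIn-injective; punchIn-punchOut; combine-injective; remQuot-combine; combine-remQuot) renaming (_≟_ to _≟ᶠ_)
open import Data.Fin.Permutation using (Permutation′; _⟨$⟩ʳ_; _⟨$⟩ˡ_; inverseˡ; inverseʳ; remove; insert; punchIn-permute; insert-remove; remove-insert)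
import Data.Fin.Permutation as Perm
open import Data.Product using (_×_; _,_; proj₁; proj₂)
open import Data.Sum using (_⊎_; inj₁; inj₂)
open import Data.Unit using (⊤; tt)
open import Data.Empty using (⊥; ⊥-elim)
open import Data.List using (List; []; _∷_)
open import Data.List.Membership.Propositional using (_∈_; _∉_)
open import Data.List.Relation.Unary.Any using (here; there)
open import Data.List.Relation.Unary.All using (All; _∷_)
import Data.List.Relation.Unary.All as All
open import Data.List.Relation.Unary.Linked using (Linked; _∷_)
open import Data.List.Relation.Unary.Linked.Properties using (Linked⇒All)
open import Relation.Binary.Definitions using (Reflexive; Transitive)
open import Relation.Binary.PropositionalEquality using (_≡_; _≢_; refl; sym; trans; cong; cong₂; subst; module ≡-Reasoning)
open import Relation.Nullary using (yes; no)
open import Function using (_∘_; _⇔_; mk⇔; Equivalence; case_of_)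
open import Function.Properties.Equivalence using () renaming (trans to ⇔-trans)

open Equivalence

_!/_! : ℕ → ℕ → ℕ
n !/ p ! = n ! / p ! where instance _ = p !≢0

lastDiff-cong : ∀ {m n n′} {f g : Fin m → Fin n} {f′ g′ : Fin m → Fin n′} →
                (∀ i → f i ≡ g i ⇔ f′ i ≡ g′ i) → lastDiff f g ≡ lastDiff f′ g′
lastDiff-cong {zero} agree = refl
lastDiff-cong {suc m} {f = f} {g} {f′} {g′} agree
  with f (fromℕ m) ≟ᶠ g (fromℕ m) | f′ (fromℕ m) ≟ᶠ g′ (fromℕ m)
... | yes _  | yes _  = lastDiff-cong (agree ∘ inject₁)
... | yes e  | no ne  = ⊥-elim (ne (to (agree _) e))
... | no ne  | yes e  = ⊥-elim (ne (from (agree _) e))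
... | no _   | no _   = refl

lastDiff-last-≡ : ∀ {m n} {f g : Fin (suc m) → Fin n} → f (fromℕ m) ≡ g (fromℕ m) →
                  lastDiff f g ≡ lastDiff (f ∘ inject₁) (g ∘ inject₁)
lastDiff-last-≡ {m} {f = f} {g} e with f (fromℕ m) ≟ᶠ g (fromℕ m)
... | yes _ = refl
... | no ne = ⊥-elim (ne e)

lastDiff-last-≢ : ∀ {m n} {f g : Fin (suc m) → Fin n} → f (fromℕ m) ≢ g (fromℕ m) →
                  lastDiff f g ≡ suc m
lastDiff-last-≢ {m} {f = f} {g} ne with f (fromℕ m) ≟ᶠ g (fromℕ m)
... | yes e = ⊥-elim (ne e)
... | no _  = refl

punchIn-fromℕ : ∀ {n} (j : Fin n) → punchIn (fromℕ n) j ≡ inject₁ j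
punchIn-fromℕ {suc n} fzero    = refl
punchIn-fromℕ {suc n} (fsuc j) = cong fsuc (punchIn-fromℕ j)

module _ {n : ℕ} {α β : Permutation′ (suc n)} {i : Fin (suc n)} (α≡β-at-i : α ⟨$⟩ʳ i ≡ β ⟨$⟩ʳ i) where

  remove-agrees : ∀ j → α ⟨$⟩ʳ punchIn i j ≡ β ⟨$⟩ʳ punchIn i j ⇔ remove i α ⟨$⟩ʳ j ≡ remove i β ⟨$⟩ʳ j
  remove-agrees j = mk⇔
    (λ e → punchIn-injective (α ⟨$⟩ʳ i) _ _ (begin
      punchIn (α ⟨$⟩ʳ i) (remove i α ⟨$⟩ʳ j) ≡⟨ punchIn-permute α i j ⟨
      α ⟨$⟩ʳ punchIn i j                     ≡⟨ e ⟩
      β ⟨$⟩ʳ punchIn i j                     ≡⟨ punchIn-permute β i j ⟩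
      punchIn (β ⟨$⟩ʳ i) (remove i β ⟨$⟩ʳ j) ≡⟨ cong (λ v → punchIn v _) α≡β-at-i ⟨
      punchIn (α ⟨$⟩ʳ i) (remove i β ⟨$⟩ʳ j) ∎))
    (λ e → begin
      α ⟨$⟩ʳ punchIn i j                     ≡⟨ punchIn-permute α i j ⟩
      punchIn (α ⟨$⟩ʳ i) (remove i α ⟨$⟩ʳ j) ≡⟨ cong₂ punchIn α≡β-at-i e ⟩
      punchIn (β ⟨$⟩ʳ i) (remove i β ⟨$⟩ʳ j) ≡⟨ punchIn-permute β i j ⟨
      β ⟨$⟩ʳ punchIn i j                     ∎)
    where open ≡-Reasoning

  ≈⇔remove-≈ : α Perm.≈ β ⇔ remove i α Perm.≈ remove i β
  ≈⇔remove-≈ = mk⇔ (λ α≈β j → to (remove-agrees j) (α≈β (punchIn i j))) remove-≈⇒≈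
    where
    remove-≈⇒≈ : remove i α Perm.≈ remove i β → α Perm.≈ β
    remove-≈⇒≈ r k with i ≟ᶠ k
    ... | yes refl = α≡β-at-i
    ... | no i≢k   = subst (λ k → α ⟨$⟩ʳ k ≡ β ⟨$⟩ʳ k) (punchIn-punchOut i≢k)
                       (from (remove-agrees (punchOut i≢k)) (r (punchOut i≢k)))

insert-at : ∀ {n} (i j : Fin (suc n)) (π : Permutation′ n) → insert i j π ⟨$⟩ʳ i ≡ j
insert-at i j π with i ≟ᶠ i
... | yes _  = refl
... | no i≢i = ⊥-elim (i≢i refl)

ρ≡lastDiff : ∀ {n} (α β : Permutation′ n) → ρ α β ≡ lastDiff (α ⟨$⟩ʳ_) (β ⟨$⟩ʳ_)
ρ≡lastDiff α β = lastDiff-cong {f′ = α ⟨$⟩ʳ_} {β ⟨$⟩ʳ_} λ i → mk⇔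
  (λ e → trans (cong (α ⟨$⟩ʳ_) (sym e)) (inverseʳ α))
  (λ e → trans (cong (α ⟨$⟩ˡ_) (sym e)) (inverseˡ α))

removeLast : ∀ {n} → Permutation′ (suc n) → Permutation′ n
removeLast {n} = remove (fromℕ n)

ρ-removeLast : ∀ {n} (α β : Permutation′ (suc n)) → α ⟨$⟩ʳ fromℕ n ≡ β ⟨$⟩ʳ fromℕ n →
               ρ α β ≡ ρ (removeLast α) (removeLast β)
ρ-removeLast {n} α β e = begin
  ρ α β                                                    ≡⟨ ρ≡lastDiff α β ⟩
  lastDiff (α ⟨$⟩ʳ_) (β ⟨$⟩ʳ_)                             ≡⟨ lastDiff-last-≡ {f = α ⟨$⟩ʳ_} {β ⟨$⟩ʳ_} e ⟩
  lastDiff ((α ⟨$⟩ʳ_) ∘ inject₁) ((β ⟨$⟩ʳ_) ∘ inject₁)     ≡⟨ lastDiff-cong agree ⟩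
  lastDiff (removeLast α ⟨$⟩ʳ_) (removeLast β ⟨$⟩ʳ_)       ≡⟨ ρ≡lastDiff (removeLast α) (removeLast β) ⟨
  ρ (removeLast α) (removeLast β)                          ∎
  where
  open ≡-Reasoning
  agree : ∀ j → α ⟨$⟩ʳ inject₁ j ≡ β ⟨$⟩ʳ inject₁ j ⇔ removeLast α ⟨$⟩ʳ j ≡ removeLast β ⟨$⟩ʳ j
  agree j = subst (λ k → (α ⟨$⟩ʳ k ≡ β ⟨$⟩ʳ k) ⇔ (removeLast α ⟨$⟩ʳ j ≡ removeLast β ⟨$⟩ʳ j))
                  (punchIn-fromℕ j) (remove-agrees {α = α} {β} e j)

ρ-last-≢ : ∀ {n} (α β : Permutation′ (suc n)) → α ⟨$⟩ʳ fromℕ n ≢ β ⟨$⟩ʳ fromℕ n → ρ α β ≡ suc n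
ρ-last-≢ α β ne = trans (ρ≡lastDiff α β) (lastDiff-last-≢ {f = α ⟨$⟩ʳ_} {β ⟨$⟩ʳ_} ne)

open _≅_

-- A Graph imposes no laws on its vertex relation; composing isomorphisms needs these.
record VertexPreorder (G : Graph) : Set where
  field
    ≈-refl  : Reflexive (_≈_ G)
    ≈-trans : Transitive (_≈_ G)

open VertexPreorder

≅-trans : ∀ {G H K} → VertexPreorder G → VertexPreorder K → G ≅ H → H ≅ K → G ≅ K
≅-trans preG preK f g = record
  { to        = to g ∘ to f
  ; from      = from f ∘ from g
  ; to-cong   = to-cong g ∘ to-cong f
  ; from-cong = from-cong f ∘ from-cong g
  ; from-to   = λ x → ≈-trans preG (from-cong f (from-to g (to f x))) (from-to f x)
  ; to-from   = λ y → ≈-trans preK (to-cong g (to-from f (from g y))) (to-from g y)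
  ; adj       = λ x y → ⇔-trans (adj f x y) (adj g (to f x) (to f y))
  }

K₁ : Graph
K₁ = record { V = ⊤ ; _≈_ = λ _ _ → ⊤ ; Adj = λ _ _ → ⊥ }

K₁-preorder : VertexPreorder K₁
K₁-preorder = record { ≈-refl = tt ; ≈-trans = λ _ _ → tt }

distanceGraph-preorder : ∀ n D → VertexPreorder (distanceGraph n D)
distanceGraph-preorder n D = record { ≈-refl = λ _ → refl ; ≈-trans = λ p q i → trans (p i) (q i) }

completeMultipartite-preorder : ∀ r m → VertexPreorder (completeMultipartite r m)
completeMultipartite-preorder r m = record { ≈-refl = refl ; ≈-trans = trans }

copies-preorder : ∀ {G} m → VertexPreorder G → VertexPreorder (copies m G)
copies-preorder m preG = record
  { ≈-refl  = refl , ≈-refl preG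
  ; ≈-trans = λ (p , q) (p′ , q′) → trans p p′ , ≈-trans preG q q′
  }

joinPow-preorder : ∀ {G} m → VertexPreorder G → VertexPreorder (joinPow G m)
joinPow-preorder m preG = record
  { ≈-refl  = refl , ≈-refl preG
  ; ≈-trans = λ (p , q) (p′ , q′) → trans p p′ , ≈-trans preG q q′
  }

Hstep-preorder : ∀ {G} p ds → VertexPreorder G → VertexPreorder (Hstep p G ds)
Hstep-preorder p []       preG = preG
Hstep-preorder p (d ∷ ds) preG = Hstep-preorder d ds (joinPow-preorder d (copies-preorder (facQuot d p) preG))

copies-cong : ∀ {G H} m → G ≅ H → copies m G ≅ copies m H
copies-cong m f = record
  { to        = λ (i , x) → i , to f x
  ; from      = λ (i , x) → i , from f x
  ; to-cong   = λ (p , q) → p , to-cong f q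
  ; from-cong = λ (p , q) → p , from-cong f q
  ; from-to   = λ (i , x) → refl , from-to f x
  ; to-from   = λ (i , x) → refl , to-from f x
  ; adj       = λ (i , x) (j , y) → mk⇔ (λ (p , a) → p , to (adj f x y) a) (λ (p , a) → p , from (adj f x y) a)
  }

joinPow-cong : ∀ {G H} m → G ≅ H → joinPow G m ≅ joinPow H m
joinPow-cong m f = record
  { to        = λ (i , x) → i , to f x
  ; from      = λ (i , x) → i , from f x
  ; to-cong   = λ (p , q) → p , to-cong f q
  ; from-cong = λ (p , q) → p , from-cong f q
  ; from-to   = λ (i , x) → refl , from-to f x
  ; to-from   = λ (i , x) → refl , to-from f x
  ; adj       = λ (i , x) (j , y) → mk⇔
      (λ { (inj₁ (p , a)) → inj₁ (p , to (adj f x y) a) ; (inj₂ i≢j) → inj₂ i≢j })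
      (λ { (inj₁ (p , a)) → inj₁ (p , from (adj f x y) a) ; (inj₂ i≢j) → inj₂ i≢j })
  }

Hstep-cong : ∀ {G G′} p ds → G ≅ G′ → Hstep p G ds ≅ Hstep p G′ ds
Hstep-cong p []       f = f
Hstep-cong p (d ∷ ds) f = Hstep-cong d ds (joinPow-cong d (copies-cong (facQuot d p) f))

copies-copies : ∀ {G} m k → VertexPreorder G → copies m (copies k G) ≅ copies (m * k) G
copies-copies m k preG = record
  { to        = λ (i , j , x) → combine i j , x
  ; from      = λ (c , x) → proj₁ (remQuot {m} k c) , proj₂ (remQuot {m} k c) , x
  ; to-cong   = λ (p , q , r) → cong₂ combine p q , r
  ; from-cong = λ (p , r) → cong (proj₁ ∘ remQuot {m} k) p , cong (proj₂ ∘ remQuot {m} k) p , r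
  ; from-to   = λ (i , j , x) → cong proj₁ (remQuot-combine i j) , cong proj₂ (remQuot-combine i j) , ≈-refl preG
  ; to-from   = λ (c , x) → combine-remQuot {m} k c , ≈-refl preG
  ; adj       = λ (i , j , x) (i′ , j′ , y) → mk⇔
      (λ (p , q , a) → cong₂ combine p q , a)
      (λ (p , a) → let (p₁ , p₂) = combine-injective i j i′ j′ p in p₁ , p₂ , a)
  }

copies-one : ∀ {G} → VertexPreorder G → G ≅ copies 1 G
copies-one preG = record
  { to        = λ x → fzero , x
  ; from      = proj₂
  ; to-cong   = λ q → refl , q
  ; from-cong = proj₂
  ; from-to   = λ _ → ≈-refl preG
  ; to-from   = λ { (fzero , x) → refl , ≈-refl preG }
  ; adj       = λ x y → mk⇔ (λ a → refl , a) proj₂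
  }

joinPow-copies-K₁ : ∀ r m → joinPow (copies m K₁) r ≅ completeMultipartite r m
joinPow-copies-K₁ r m = record
  { to        = λ (i , a , _) → i , a
  ; from      = λ (i , a) → i , a , tt
  ; to-cong   = λ (p , q , _) → cong₂ _,_ p q
  ; from-cong = λ { refl → refl , refl , tt }
  ; from-to   = λ _ → refl , refl , tt
  ; to-from   = λ _ → refl
  ; adj       = λ _ _ → mk⇔ (λ { (inj₁ (_ , _ , ())) ; (inj₂ i≢j) → i≢j }) inj₂
  }

distanceGraph-zero : ∀ D → distanceGraph 0 D ≅ K₁
distanceGraph-zero D = record
  { to        = λ _ → tt
  ; from      = λ _ → Perm.id
  ; to-cong   = λ _ → tt
  ; from-cong = λ _ ()
  ; from-to   = λ _ ()
  ; to-from   = λ _ → tt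
  ; adj       = λ α β → mk⇔ (λ (α≉β , _) → α≉β (λ ())) λ ()
  }

splitLast : ∀ {n} → Permutation′ (suc n) → Fin (suc n) × Permutation′ n
splitLast {n} α = α ⟨$⟩ʳ fromℕ n , removeLast α

splitLast-≅ : ∀ {n} D (Adj′ : Fin (suc n) × Permutation′ n → Fin (suc n) × Permutation′ n → Set) →
              (∀ α β → Adj (distanceGraph (suc n) D) α β ⇔ Adj′ (splitLast α) (splitLast β)) →
              distanceGraph (suc n) D ≅
                record { V = Fin (suc n) × Permutation′ n
                       ; _≈_ = λ (v , π) (w , σ) → v ≡ w × π Perm.≈ σ
                       ; Adj = Adj′ }
splitLast-≅ {n} D Adj′ splitLast-adj = record
  { to        = splitLast
  ; from      = glueLast
  ; to-cong   = λ {α} {β} α≈β → α≈β (fromℕ n) , to (≈⇔remove-≈ {α = α} {β} (α≈β (fromℕ n))) α≈β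
  ; from-cong = glueLast-cong
  ; from-to   = insert-remove (fromℕ n)
  ; to-from   = λ (v , π) → insert-at (fromℕ n) v π , remove-insert (fromℕ n) v π
  ; adj       = splitLast-adj
  }
  where
  glueLast : Fin (suc n) × Permutation′ n → Permutation′ (suc n)
  glueLast (v , π) = insert (fromℕ n) v π

  glueLast-cong : ∀ {x y} → proj₁ x ≡ proj₁ y × proj₂ x Perm.≈ proj₂ y → glueLast x Perm.≈ glueLast y
  glueLast-cong {v , π} {w , σ} (v≡w , π≈σ) =
    from (≈⇔remove-≈ {α = glueLast (v , π)} {glueLast (w , σ)} last-agrees) λ j → begin
      removeLast (glueLast (v , π)) ⟨$⟩ʳ j ≡⟨ remove-insert (fromℕ n) v π j ⟩
      π ⟨$⟩ʳ j                             ≡⟨ π≈σ j ⟩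
      σ ⟨$⟩ʳ j                             ≡⟨ remove-insert (fromℕ n) w σ j ⟨
      removeLast (glueLast (w , σ)) ⟨$⟩ʳ j ∎
    where
    open ≡-Reasoning
    last-agrees : glueLast (v , π) ⟨$⟩ʳ fromℕ n ≡ glueLast (w , σ) ⟨$⟩ʳ fromℕ n
    last-agrees = trans (insert-at (fromℕ n) v π) (trans v≡w (sym (insert-at (fromℕ n) w σ)))

module _ {n : ℕ} {D : List ℕ} (α β : Permutation′ (suc n)) where

  adj-last-≡ : α ⟨$⟩ʳ fromℕ n ≡ β ⟨$⟩ʳ fromℕ n →
               Adj (distanceGraph (suc n) D) α β ⇔ Adj (distanceGraph n D) (removeLast α) (removeLast β)
  adj-last-≡ e = mk⇔
    (λ (α≉β , ρ∈D) → α≉β ∘ from α≈β⇔ , subst (_∈ D) (ρ-removeLast α β e) ρ∈D)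
    (λ (α≉β , ρ∈D) → α≉β ∘ to α≈β⇔ , subst (_∈ D) (sym (ρ-removeLast α β e)) ρ∈D)
    where α≈β⇔ = ≈⇔remove-≈ {α = α} {β} e

  adj-last-≢ : α ⟨$⟩ʳ fromℕ n ≢ β ⟨$⟩ʳ fromℕ n → Adj (distanceGraph (suc n) D) α β ⇔ suc n ∈ D
  adj-last-≢ ne = mk⇔
    (λ (_ , ρ∈D) → subst (_∈ D) (ρ-last-≢ α β ne) ρ∈D)
    (λ n+1∈D → (λ α≈β → ne (α≈β (fromℕ n))) , subst (_∈ D) (sym (ρ-last-≢ α β ne)) n+1∈D)

distanceGraph-suc-∉ : ∀ {n D} → suc n ∉ D → distanceGraph (suc n) D ≅ copies (suc n) (distanceGraph n D)
distanceGraph-suc-∉ {n} {D} n+1∉D = splitLast-≅ D _ split-adj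
  where
  split-adj : ∀ α β → Adj (distanceGraph (suc n) D) α β ⇔
        (α ⟨$⟩ʳ fromℕ n ≡ β ⟨$⟩ʳ fromℕ n × Adj (distanceGraph n D) (removeLast α) (removeLast β))
  split-adj α β with α ⟨$⟩ʳ fromℕ n ≟ᶠ β ⟨$⟩ʳ fromℕ n
  ... | yes e = mk⇔ (λ a → e , to (adj-last-≡ α β e) a) (λ (_ , a) → from (adj-last-≡ α β e) a)
  ... | no ne = mk⇔ (λ a → ⊥-elim (n+1∉D (to (adj-last-≢ α β ne) a))) (λ (e , _) → ⊥-elim (ne e))

distanceGraph-suc-∈ : ∀ {n D} → suc n ∈ D → distanceGraph (suc n) D ≅ joinPow (distanceGraph n D) (suc n)
distanceGraph-suc-∈ {n} {D} n+1∈D = splitLast-≅ D _ split-adj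
  where
  split-adj : ∀ α β → Adj (distanceGraph (suc n) D) α β ⇔
        ((α ⟨$⟩ʳ fromℕ n ≡ β ⟨$⟩ʳ fromℕ n × Adj (distanceGraph n D) (removeLast α) (removeLast β))
          ⊎ α ⟨$⟩ʳ fromℕ n ≢ β ⟨$⟩ʳ fromℕ n)
  split-adj α β with α ⟨$⟩ʳ fromℕ n ≟ᶠ β ⟨$⟩ʳ fromℕ n
  ... | yes e = mk⇔ (λ a → inj₁ (e , to (adj-last-≡ α β e) a))
                    (λ { (inj₁ (_ , a)) → from (adj-last-≡ α β e) a ; (inj₂ ne) → ⊥-elim (ne e) })
  ... | no ne = mk⇔ (λ _ → inj₂ ne) (λ _ → from (adj-last-≢ α β ne) n+1∈D)

distanceGraph-extend : ∀ {D p G} → VertexPreorder G → distanceGraph p D ≅ G →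
                       ∀ {n} → p ≤′ n → (∀ {m} → p < m → m ≤ n → m ∉ D) →
                       distanceGraph n D ≅ copies (n !/ p !) G
distanceGraph-extend {D} {p} {G} preG iso ≤′-refl _ =
  subst (λ c → distanceGraph p D ≅ copies c G) (sym (n/n≡1 (p !) ⦃ p !≢0 ⦄))
    (≅-trans (distanceGraph-preorder p D) (copies-preorder 1 preG) iso (copies-one preG))
distanceGraph-extend {D} {p} {G} preG iso {suc n} (≤′-step p≤′n) gap =
  subst (λ c → distanceGraph (suc n) D ≅ copies c G) (sym (*-/-assoc (suc n) ⦃ p !≢0 ⦄ (m≤n⇒m!∣n! p≤n)))
    (≅-trans (distanceGraph-preorder (suc n) D) (copies-preorder _ preG)
      (distanceGraph-suc-∉ (gap (s≤s p≤n) ≤-refl))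
      (≅-trans (copies-preorder (suc n) (distanceGraph-preorder n D)) (copies-preorder _ preG)
        (copies-cong (suc n) (distanceGraph-extend preG iso p≤′n (λ p<m m≤n → gap p<m (m≤n⇒m≤1+n m≤n))))
        (copies-copies (suc n) (n !/ p !) preG)))
  where p≤n = ≤′⇒≤ p≤′n

lastOf-∈ : ∀ d ds → lastOf d ds ∈ d ∷ ds
lastOf-∈ d []       = here refl
lastOf-∈ d (e ∷ es) = there (lastOf-∈ e es)

distanceGraph≅Hstep : ∀ {D} p ds {G} → VertexPreorder G → distanceGraph p D ≅ G →
                      Linked _<_ (p ∷ ds) → All (_∈ D) ds → (∀ {m} → p < m → m ∈ D → m ∈ ds) →
                      ∀ {n} → lastOf p ds ≤ n → distanceGraph n D ≅ copies (n !/ lastOf p ds !) (Hstep p G ds)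
distanceGraph≅Hstep p [] preG iso _ _ D-above-p p≤n =
  distanceGraph-extend preG iso (≤⇒≤′ p≤n) λ p<m _ m∈D → case D-above-p p<m m∈D of λ ()
distanceGraph≅Hstep {D} p (suc d ∷ ds) {G} preG iso (s≤s p≤d ∷ linked) (d+1∈D ∷ ds⊆D) D-above-p =
  distanceGraph≅Hstep (suc d) ds preStep step≅ linked ds⊆D D-above-d+1
  where
  preStep = joinPow-preorder (suc d) (copies-preorder (facQuot (suc d) p) preG)

  ds-above-d : All (d <_) (suc d ∷ ds)
  ds-above-d = Linked⇒All <-trans ≤-refl linked

  step≅ : distanceGraph (suc d) D ≅ joinPow (copies (facQuot (suc d) p) G) (suc d)
  step≅ = ≅-trans (distanceGraph-preorder (suc d) D) preStep (distanceGraph-suc-∈ d+1∈D)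
         (joinPow-cong (suc d) (distanceGraph-extend preG iso (≤⇒≤′ p≤d) λ p<m m≤d m∈D →
           <⇒≱ (All.lookup ds-above-d (D-above-p p<m m∈D)) m≤d))

  D-above-d+1 : ∀ {m} → suc d < m → m ∈ D → m ∈ ds
  D-above-d+1 d+1<m m∈D with D-above-p (<-trans (s≤s p≤d) d+1<m) m∈D
  ... | here refl = ⊥-elim (<-irrefl refl d+1<m)
  ... | there m∈ds = m∈ds

theorem4p2 : (n : ℕ) → 2 ≤ n → (d₁ : ℕ) → (ds : List ℕ) →
    2 ≤ d₁ → Linked _<_ (d₁ ∷ ds) → All (_≤ n) (d₁ ∷ ds) →
    distanceGraph n (d₁ ∷ ds)
      ≅ copies (_/_ (n !) (lastOf d₁ ds !) ⦃ lastOf d₁ ds !≢0 ⦄) (H d₁ ds)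
-- Starting at p = 0 from G(S₀, D) = K₁, the first step of Hstep builds H₁ (as 0! = 1).
theorem4p2 n _ d₁ ds 2≤d₁ linked D≤n =
  ≅-trans (distanceGraph-preorder n D) (copies-preorder _ (Hstep-preorder d₁ ds (completeMultipartite-preorder _ _)))
    G≅Hstep (copies-cong _ (Hstep-cong d₁ ds H₁≅))
  where
  D = d₁ ∷ ds

  G≅Hstep : distanceGraph n D ≅ copies (n !/ lastOf d₁ ds !) (Hstep 0 K₁ D)
  G≅Hstep = distanceGraph≅Hstep 0 D K₁-preorder (distanceGraph-zero D) (≤-trans (s≤s z≤n) 2≤d₁ ∷ linked)
              (All.tabulate λ d∈D → d∈D) (λ _ m∈D → m∈D) (All.lookup D≤n (lastOf-∈ d₁ ds))

  H₁≅ : joinPow (copies (facQuot d₁ 0) K₁) d₁ ≅ completeMultipartite d₁ ((d₁ ∸ 1) !)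
  H₁≅ = subst (λ m → joinPow (copies m K₁) d₁ ≅ completeMultipartite d₁ ((d₁ ∸ 1) !))
          (sym (n/1≡n ((d₁ ∸ 1) !))) (joinPow-copies-K₁ d₁ ((d₁ ∸ 1) !))
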